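{- Let $\Gamma$ be an environment, $\Delta$ a type environment, $e$ evidence and $T$ a type of $\mathbf{F}_2^\mu$. If $\Gamma \vdash e : T$ and $\Delta \vdash T : *$ or $\Delta\vdash T : o$ in $\mathbf{F}_2^\mu$, then $\theta(\Gamma) \vdash |e| : \theta(T)$ in the $\lambda$-Y calculus.
   Context: System $\mathbf{F}_2^\mu$: evidence $e ::= \alpha \mid \kappa \mid \lambda\alpha.e \mid e\,e' \mid \mu\alpha.e \mid e\,T \mid \lambda x.e$; term kinds $K::=*\mid*\Rightarrow K$, kinds $k::=o\mid K$; types $T ::= F \mid x \mid \lambda x.T \mid \forall x{:}K.T \mid T\,T' \mid T \Rightarrow T'$; environments $\Gamma ::= \cdot\mid\alpha:T,\Gamma\mid\kappa:T,\Gamma$, type environments $\Delta::=\cdot\mid x:K,\Delta\mid F:K,\Delta$. Kinding: $x$/$F$ get their declared kind; $T_2\,T_1:K$ if $T_1:*$, $T_2:*\Rightarrow K$; $\lambda x.T:*\Rightarrow K$ if $\Delta,x:*\vdash T:K$ and $x\in\mathrm{FV}(T)$; $\forall x{:}K.T:o$ if $\Delta,x:K\vdash T$ has kind $o$ or $*$; $T\Rightarrow T':o$ if each of $T,T'$ has kind $o$ or $*$. Typing: declared variables/constants; (App) from $e_1:T'$, $e_2:T'\Rightarrow T$ infer $e_2\,e_1:T$; (Lam) from $\Gamma,\alpha:T'\vdash e:T$ infer $\lambda\alpha.e:T'\Rightarrow T$; (Mu) from $\Gamma,\alpha:T\vdash e:T$ infer $\mu\alpha.e:T$; (Inst) from $e:\forall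 x{:}K.T$ infer $e\,T':[T'/x]T$; (Abs) from $e:T$, $x\notin\mathrm{FV}(\Gamma)$ infer $\lambda x.e:\forall x{:}K.T$; (Conv) from $e:T$, $T\leftrightarrow_o^*T'$ infer $e:T'$, where $\to_o$ is the compatible closure of $(\lambda x.T)T'\to_o[T'/x]T$; all types are well-kinded. Erasure: $|\alpha|=\alpha$, $|\kappa|=\kappa$, $|\lambda\alpha.e|=\lambda\alpha.|e|$, $|\mu\alpha.e|=\mu\alpha.|e|$, $|e\,e'|=|e|\,|e'|$, $|\lambda x.e|=|e|$, $|e\,T|=|e|$. The $\lambda$-Y calculus: terms $e::=\alpha\mid\kappa\mid\lambda\alpha.e\mid e\,e'\mid\mu\alpha.e$, types $T::=B\mid T\Rightarrow T'$ with a single base type $B$, typed by the usual variable/constant, application, abstraction rules and the fixpoint rule (from $\Gamma,\alpha:T\vdash e:T$ infer $\Gamma\vdash\mu\alpha.e:T$). The map $\theta$: $\theta(F)=\theta(x)=B$, $\theta(\lambda x.T)=\theta(T)$, $\theta(T\,T')=\theta(T)$, $\theta(T\Rightarrow T')=\theta(T)\Rightarrow\theta(T')$, $\theta(\forall x{:}K.T)=\theta(T)$; $\theta(\Gamma)$ applies $\theta$ to every type in $\Gamma$. -}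

module Defs where

open import Data.Nat using (ℕ; zero; suc; _≡ᵇ_)
open import Data.Bool using (if_then_else_)
open import Data.List using (List; []; _∷_; map)
open import Data.List.Membership.Propositional using (_∈_)
open import Data.Maybe using (Maybe; just; nothing)
open import Data.Product using (_×_; _,_)
open import Data.Sum using (_⊎_)
open import Relation.Binary.PropositionalEquality using (_≡_)
open import Relation.Binary.Construct.Closure.Equivalence using (EqClosure)

-- Kinds of F₂^μ
--   term kinds  K ::= * | * ⇒ K
--   kinds       k ::= o | K

data TKind : Set where
  ⋆    : TKind
  ⋆⇒_  : TKind → TKind

data Kind : Set where
  o   : Kind
  ⌜_⌝ : TKind → Kind

-- Types of F₂^μ.  Type constants F are names (ℕ); type variables x are
-- de Bruijn indices (binders: λx.T and ∀x:K.T).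

data Ty : Set where
  con  : ℕ → Ty
  var  : ℕ → Ty
  lam  : Ty → Ty
  all  : TKind → Ty → Ty
  app  : Ty → Ty → Ty
  _⇒_  : Ty → Ty → Ty

infixr 7 _⇒_

ext : (ℕ → ℕ) → ℕ → ℕ
ext ρ zero    = zero
ext ρ (suc n) = suc (ρ n)

rename : (ℕ → ℕ) → Ty → Ty
rename ρ (con F)   = con F
rename ρ (var x)   = var (ρ x)
rename ρ (lam T)   = lam (rename (ext ρ) T)
rename ρ (all K T) = all K (rename (ext ρ) T)
rename ρ (app T U) = app (rename ρ T) (rename ρ U)
rename ρ (T ⇒ U)   = rename ρ T ⇒ rename ρ U

exts : (ℕ → Ty) → ℕ → Ty
exts σ zero    = var zero
exts σ (suc n) = rename suc (σ n)

subst : (ℕ → Ty) → Ty → Ty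
subst σ (con F)   = con F
subst σ (var x)   = σ x
subst σ (lam T)   = lam (subst (exts σ) T)
subst σ (all K T) = all K (subst (exts σ) T)
subst σ (app T U) = app (subst σ T) (subst σ U)
subst σ (T ⇒ U)   = subst σ T ⇒ subst σ U

-- single substitution [T'/x]T where x is the innermost bound variable (index 0)
sub0 : Ty → ℕ → Ty
sub0 U zero    = U
sub0 U (suc n) = var n

_[_] : Ty → Ty → Ty
T [ U ] = subst (sub0 U) T

data _∈FV_ : ℕ → Ty → Set where
  fv-var   : ∀ {n} → n ∈FV var n
  fv-lam   : ∀ {n T} → suc n ∈FV T → n ∈FV lam T
  fv-all   : ∀ {n K T} → suc n ∈FV T → n ∈FV all K T
  fv-appˡ  : ∀ {n T U} → n ∈FV T → n ∈FV app T U
  fv-appʳ  : ∀ {n T U} → n ∈FV U → n ∈FV app T U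
  fv-⇒ˡ    : ∀ {n T U} → n ∈FV T → n ∈FV (T ⇒ U)
  fv-⇒ʳ    : ∀ {n T U} → n ∈FV U → n ∈FV (T ⇒ U)

-- Type environments Δ: the constant part (F : K declarations) and the
-- variable part (x : K declarations, de Bruijn: head = index 0).

ConEnv : Set
ConEnv = List (ℕ × TKind)

VarEnv : Set
VarEnv = List TKind

data _∋_∶_ : VarEnv → ℕ → TKind → Set where
  here  : ∀ {Ψ K} → (K ∷ Ψ) ∋ zero ∶ K
  there : ∀ {Ψ K K' n} → Ψ ∋ n ∶ K → (K' ∷ Ψ) ∋ suc n ∶ K

data _︔_⊢_∶_ (Φ : ConEnv) : VarEnv → Ty → Kind → Set where
  k-con : ∀ {Ψ F K} → (F , K) ∈ Φ → Φ ︔ Ψ ⊢ con F ∶ ⌜ K ⌝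
  k-var : ∀ {Ψ x K} → Ψ ∋ x ∶ K → Φ ︔ Ψ ⊢ var x ∶ ⌜ K ⌝
  k-app : ∀ {Ψ T₁ T₂ K} → Φ ︔ Ψ ⊢ T₁ ∶ ⌜ ⋆ ⌝ → Φ ︔ Ψ ⊢ T₂ ∶ ⌜ ⋆⇒ K ⌝
        → Φ ︔ Ψ ⊢ app T₂ T₁ ∶ ⌜ K ⌝
  k-lam : ∀ {Ψ T K} → Φ ︔ (⋆ ∷ Ψ) ⊢ T ∶ ⌜ K ⌝ → zero ∈FV T
        → Φ ︔ Ψ ⊢ lam T ∶ ⌜ ⋆⇒ K ⌝
  k-all : ∀ {Ψ T K} → (Φ ︔ (K ∷ Ψ) ⊢ T ∶ o ⊎ Φ ︔ (K ∷ Ψ) ⊢ T ∶ ⌜ ⋆ ⌝)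
        → Φ ︔ Ψ ⊢ all K T ∶ o
  k-⇒   : ∀ {Ψ T T'} → (Φ ︔ Ψ ⊢ T ∶ o ⊎ Φ ︔ Ψ ⊢ T ∶ ⌜ ⋆ ⌝)
        → (Φ ︔ Ψ ⊢ T' ∶ o ⊎ Φ ︔ Ψ ⊢ T' ∶ ⌜ ⋆ ⌝)
        → Φ ︔ Ψ ⊢ (T ⇒ T') ∶ o

_︔_⊢_type : ConEnv → VarEnv → Ty → Set
Φ ︔ Ψ ⊢ T type = Φ ︔ Ψ ⊢ T ∶ ⌜ ⋆ ⌝ ⊎ Φ ︔ Ψ ⊢ T ∶ o

data _→o_ : Ty → Ty → Set where
  beta   : ∀ {T U} → app (lam T) U →o (T [ U ])
  ξ-lam  : ∀ {T T'} → T →o T' → lam T →o lam T'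
  ξ-all  : ∀ {K T T'} → T →o T' → all K T →o all K T'
  ξ-appˡ : ∀ {T T' U} → T →o T' → app T U →o app T' U
  ξ-appʳ : ∀ {T U U'} → U →o U' → app T U →o app T U'
  ξ-⇒ˡ   : ∀ {T T' U} → T →o T' → (T ⇒ U) →o (T' ⇒ U)
  ξ-⇒ʳ   : ∀ {T U U'} → U →o U' → (T ⇒ U) →o (T ⇒ U')

_↔o*_ : Ty → Ty → Set
_↔o*_ = EqClosure _→o_

-- Environments Γ ::= · | α : T , Γ | κ : T , Γ  (generic in the type set)

data Entry (A : Set) : Set where
  evar : ℕ → A → Entry A
  econ : ℕ → A → Entry A

mapEntry : {A B : Set} → (A → B) → Entry A → Entry B
mapEntry f (evar α T) = evar α (f T)
mapEntry f (econ κ T) = econ κ (f T)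

-- lookup of the (most recent) declaration of a variable / constant
lookupVar : {A : Set} → List (Entry A) → ℕ → Maybe A
lookupVar []               α = nothing
lookupVar (evar β T ∷ Γ)   α = if α ≡ᵇ β then just T else lookupVar Γ α
lookupVar (econ _ _ ∷ Γ)   α = lookupVar Γ α

lookupCon : {A : Set} → List (Entry A) → ℕ → Maybe A
lookupCon []               κ = nothing
lookupCon (evar _ _ ∷ Γ)   κ = lookupCon Γ κ
lookupCon (econ β T ∷ Γ)   κ = if κ ≡ᵇ β then just T else lookupCon Γ κ

Env : Set
Env = List (Entry Ty)

-- shifting all types of Γ (the de Bruijn form of  x ∉ FV(Γ))
⇑ : Env → Env
⇑ = map (mapEntry (rename suc))

data Ev : Set where
  var  : ℕ → Ev
  con  : ℕ → Ev
  lam  : ℕ → Ev → Ev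
  app  : Ev → Ev → Ev
  mu   : ℕ → Ev → Ev
  tapp : Ev → Ty → Ev
  tlam : Ev → Ev

data _︔_︔_⊢_∶_ (Φ : ConEnv) : VarEnv → Env → Ev → Ty → Set where
  t-var  : ∀ {Ψ Γ α T} → lookupVar Γ α ≡ just T → Φ ︔ Ψ ⊢ T type
         → Φ ︔ Ψ ︔ Γ ⊢ var α ∶ T
  t-con  : ∀ {Ψ Γ κ T} → lookupCon Γ κ ≡ just T → Φ ︔ Ψ ⊢ T type
         → Φ ︔ Ψ ︔ Γ ⊢ con κ ∶ T
  t-app  : ∀ {Ψ Γ e₁ e₂ T T'} → Φ ︔ Ψ ︔ Γ ⊢ e₁ ∶ T' → Φ ︔ Ψ ︔ Γ ⊢ e₂ ∶ (T' ⇒ T)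
         → Φ ︔ Ψ ︔ Γ ⊢ app e₂ e₁ ∶ T
  t-lam  : ∀ {Ψ Γ α e T T'} → Φ ︔ Ψ ⊢ T' type → Φ ︔ Ψ ︔ (evar α T' ∷ Γ) ⊢ e ∶ T
         → Φ ︔ Ψ ︔ Γ ⊢ lam α e ∶ (T' ⇒ T)
  t-mu   : ∀ {Ψ Γ α e T} → Φ ︔ Ψ ⊢ T type → Φ ︔ Ψ ︔ (evar α T ∷ Γ) ⊢ e ∶ T
         → Φ ︔ Ψ ︔ Γ ⊢ mu α e ∶ T
  t-inst : ∀ {Ψ Γ e K T T'} → Φ ︔ Ψ ︔ Γ ⊢ e ∶ all K T → Φ ︔ Ψ ⊢ T' ∶ ⌜ K ⌝
         → Φ ︔ Ψ ︔ Γ ⊢ tapp e T' ∶ (T [ T' ])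
  t-abs  : ∀ {Ψ Γ e K T} → Φ ︔ (K ∷ Ψ) ︔ ⇑ Γ ⊢ e ∶ T
         → Φ ︔ Ψ ︔ Γ ⊢ tlam e ∶ all K T
  t-conv : ∀ {Ψ Γ e T T'} → Φ ︔ Ψ ︔ Γ ⊢ e ∶ T → T ↔o* T' → Φ ︔ Ψ ⊢ T' type
         → Φ ︔ Ψ ︔ Γ ⊢ e ∶ T'

data YTy : Set where
  B    : YTy
  _⇒Y_ : YTy → YTy → YTy

infixr 7 _⇒Y_

data YTm : Set where
  var : ℕ → YTm
  con : ℕ → YTm
  lam : ℕ → YTm → YTm
  app : YTm → YTm → YTm
  mu  : ℕ → YTm → YTm

YEnv : Set
YEnv = List (Entry YTy)

data _⊢Y_∶_ : YEnv → YTm → YTy → Set where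
  y-var : ∀ {Γ α T} → lookupVar Γ α ≡ just T → Γ ⊢Y var α ∶ T
  y-con : ∀ {Γ κ T} → lookupCon Γ κ ≡ just T → Γ ⊢Y con κ ∶ T
  y-app : ∀ {Γ e₁ e₂ T T'} → Γ ⊢Y e₁ ∶ T' → Γ ⊢Y e₂ ∶ (T' ⇒Y T)
        → Γ ⊢Y app e₂ e₁ ∶ T
  y-lam : ∀ {Γ α e T T'} → (evar α T' ∷ Γ) ⊢Y e ∶ T → Γ ⊢Y lam α e ∶ (T' ⇒Y T)
  y-mu  : ∀ {Γ α e T} → (evar α T ∷ Γ) ⊢Y e ∶ T → Γ ⊢Y mu α e ∶ T

∣_∣ : Ev → YTm
∣ var α ∣    = var α
∣ con κ ∣    = con κ
∣ lam α e ∣  = lam α ∣ e ∣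
∣ app e e' ∣ = app ∣ e ∣ ∣ e' ∣
∣ mu α e ∣   = mu α ∣ e ∣
∣ tapp e T ∣ = ∣ e ∣
∣ tlam e ∣   = ∣ e ∣

θ : Ty → YTy
θ (con F)   = B
θ (var x)   = B
θ (lam T)   = θ T
θ (app T U) = θ T
θ (T ⇒ U)   = θ T ⇒Y θ U
θ (all K T) = θ T

θΓ : Env → YEnv
θΓ = map (mapEntry θ)

module Submission where

-- The proof is an induction on the typing derivation; every rule maps to
-- the corresponding λ-Y rule, except three that change the type without
-- changing the erased term, and each needs θ to be invariant:
--   (Abs)  shifting Γ under a type binder does not change θ(Γ);
--   (Inst) θ([T'/x]T) = θ(T) because T' has a term kind, so θ(T') = B;
--   (Conv) θ(T) = θ(T') whenever T ↔o* T' and both are well kinded.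
-- The last point is the substantial one.  θ is not invariant under an
-- arbitrary β-step (θ((λx.x) (F ⇒ F)) = B but θ(F ⇒ F) = B ⇒ B); it is
-- invariant on types whose application arguments all erase to B
-- ("base-argument" types), a class closed under reduction and containing
-- every well-kinded type.  A conversion chain may pass through other
-- types, so we use confluence (Takahashi's parallel reduction and complete
-- development) to replace the chain by two reduction sequences from the
-- well-kinded ends, along which θ is preserved.

open import Defs
open import Data.Sum using (_⊎_; inj₁; inj₂)
open import Data.Nat using (ℕ; zero; suc; _≡ᵇ_)
open import Data.Bool using (true; false)
open import Data.List using ([]; _∷_; map)
import Data.Maybe as Maybe
open import Data.Product using (_×_; _,_; ∃-syntax)
open import Function using (_∘_)
open import Relation.Binary.PropositionalEquality
  using (_≡_; refl; sym; trans; cong; cong₂; module ≡-Reasoning)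
  renaming (subst to transport)
open import Relation.Binary.Construct.Closure.Symmetric using (fwd; bwd)
open import Relation.Binary.Construct.Closure.ReflexiveTransitive
  using (Star; ε; _◅_; _◅◅_)

-- Renaming and substitution

ext-cong : ∀ {ρ ρ'} → (∀ x → ρ x ≡ ρ' x) → ∀ x → ext ρ x ≡ ext ρ' x
ext-cong h zero    = refl
ext-cong h (suc x) = cong suc (h x)

exts-cong : ∀ {σ σ'} → (∀ x → σ x ≡ σ' x) → ∀ x → exts σ x ≡ exts σ' x
exts-cong h zero    = refl
exts-cong h (suc x) = cong (rename suc) (h x)

ren-cong : ∀ {ρ ρ'} → (∀ x → ρ x ≡ ρ' x) → ∀ T → rename ρ T ≡ rename ρ' T
ren-cong h (con F)   = refl
ren-cong h (var x)   = cong var (h x)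
ren-cong h (lam T)   = cong lam (ren-cong (ext-cong h) T)
ren-cong h (all K T) = cong (all K) (ren-cong (ext-cong h) T)
ren-cong h (app T U) = cong₂ app (ren-cong h T) (ren-cong h U)
ren-cong h (T ⇒ U)   = cong₂ _⇒_ (ren-cong h T) (ren-cong h U)

sub-cong : ∀ {σ σ'} → (∀ x → σ x ≡ σ' x) → ∀ T → subst σ T ≡ subst σ' T
sub-cong h (con F)   = refl
sub-cong h (var x)   = h x
sub-cong h (lam T)   = cong lam (sub-cong (exts-cong h) T)
sub-cong h (all K T) = cong (all K) (sub-cong (exts-cong h) T)
sub-cong h (app T U) = cong₂ app (sub-cong h T) (sub-cong h U)
sub-cong h (T ⇒ U)   = cong₂ _⇒_ (sub-cong h T) (sub-cong h U)

ext-∘ : ∀ ρ ρ' x → ext ρ (ext ρ' x) ≡ ext (ρ ∘ ρ') x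
ext-∘ ρ ρ' zero    = refl
ext-∘ ρ ρ' (suc x) = refl

ren-ren : ∀ ρ ρ' T → rename ρ (rename ρ' T) ≡ rename (ρ ∘ ρ') T
ren-ren ρ ρ' (con F)   = refl
ren-ren ρ ρ' (var x)   = refl
ren-ren ρ ρ' (lam T)   =
  cong lam (trans (ren-ren (ext ρ) (ext ρ') T) (ren-cong (ext-∘ ρ ρ') T))
ren-ren ρ ρ' (all K T) =
  cong (all K) (trans (ren-ren (ext ρ) (ext ρ') T) (ren-cong (ext-∘ ρ ρ') T))
ren-ren ρ ρ' (app T U) = cong₂ app (ren-ren ρ ρ' T) (ren-ren ρ ρ' U)
ren-ren ρ ρ' (T ⇒ U)   = cong₂ _⇒_ (ren-ren ρ ρ' T) (ren-ren ρ ρ' U)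

exts-ext : ∀ σ ρ x → exts σ (ext ρ x) ≡ exts (σ ∘ ρ) x
exts-ext σ ρ zero    = refl
exts-ext σ ρ (suc x) = refl

sub-ren : ∀ σ ρ T → subst σ (rename ρ T) ≡ subst (σ ∘ ρ) T
sub-ren σ ρ (con F)   = refl
sub-ren σ ρ (var x)   = refl
sub-ren σ ρ (lam T)   =
  cong lam (trans (sub-ren (exts σ) (ext ρ) T) (sub-cong (exts-ext σ ρ) T))
sub-ren σ ρ (all K T) =
  cong (all K) (trans (sub-ren (exts σ) (ext ρ) T) (sub-cong (exts-ext σ ρ) T))
sub-ren σ ρ (app T U) = cong₂ app (sub-ren σ ρ T) (sub-ren σ ρ U)
sub-ren σ ρ (T ⇒ U)   = cong₂ _⇒_ (sub-ren σ ρ T) (sub-ren σ ρ U)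

ren-exts : ∀ ρ σ x → rename (ext ρ) (exts σ x) ≡ exts (rename ρ ∘ σ) x
ren-exts ρ σ zero    = refl
ren-exts ρ σ (suc x) =
  trans (ren-ren (ext ρ) suc (σ x)) (sym (ren-ren suc ρ (σ x)))

ren-sub : ∀ ρ σ T → rename ρ (subst σ T) ≡ subst (rename ρ ∘ σ) T
ren-sub ρ σ (con F)   = refl
ren-sub ρ σ (var x)   = refl
ren-sub ρ σ (lam T)   =
  cong lam (trans (ren-sub (ext ρ) (exts σ) T) (sub-cong (ren-exts ρ σ) T))
ren-sub ρ σ (all K T) =
  cong (all K) (trans (ren-sub (ext ρ) (exts σ) T) (sub-cong (ren-exts ρ σ) T))
ren-sub ρ σ (app T U) = cong₂ app (ren-sub ρ σ T) (ren-sub ρ σ U)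
ren-sub ρ σ (T ⇒ U)   = cong₂ _⇒_ (ren-sub ρ σ T) (ren-sub ρ σ U)

sub-exts : ∀ τ σ x → subst (exts τ) (exts σ x) ≡ exts (subst τ ∘ σ) x
sub-exts τ σ zero    = refl
sub-exts τ σ (suc x) =
  trans (sub-ren (exts τ) suc (σ x)) (sym (ren-sub suc τ (σ x)))

sub-sub : ∀ τ σ T → subst τ (subst σ T) ≡ subst (subst τ ∘ σ) T
sub-sub τ σ (con F)   = refl
sub-sub τ σ (var x)   = refl
sub-sub τ σ (lam T)   =
  cong lam (trans (sub-sub (exts τ) (exts σ) T) (sub-cong (sub-exts τ σ) T))
sub-sub τ σ (all K T) =
  cong (all K) (trans (sub-sub (exts τ) (exts σ) T) (sub-cong (sub-exts τ σ) T))
sub-sub τ σ (app T U) = cong₂ app (sub-sub τ σ T) (sub-sub τ σ U)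
sub-sub τ σ (T ⇒ U)   = cong₂ _⇒_ (sub-sub τ σ T) (sub-sub τ σ U)

exts-var : ∀ x → exts var x ≡ var x
exts-var zero    = refl
exts-var (suc x) = refl

sub-id : ∀ T → subst var T ≡ T
sub-id (con F)   = refl
sub-id (var x)   = refl
sub-id (lam T)   = cong lam (trans (sub-cong exts-var T) (sub-id T))
sub-id (all K T) = cong (all K) (trans (sub-cong exts-var T) (sub-id T))
sub-id (app T U) = cong₂ app (sub-id T) (sub-id U)
sub-id (T ⇒ U)   = cong₂ _⇒_ (sub-id T) (sub-id U)

ext-as-exts : ∀ ρ x → var (ext ρ x) ≡ exts (var ∘ ρ) x
ext-as-exts ρ zero    = refl
ext-as-exts ρ (suc x) = refl

ren-as-sub : ∀ ρ T → rename ρ T ≡ subst (var ∘ ρ) T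
ren-as-sub ρ (con F)   = refl
ren-as-sub ρ (var x)   = refl
ren-as-sub ρ (lam T)   =
  cong lam (trans (ren-as-sub (ext ρ) T) (sub-cong (ext-as-exts ρ) T))
ren-as-sub ρ (all K T) =
  cong (all K) (trans (ren-as-sub (ext ρ) T) (sub-cong (ext-as-exts ρ) T))
ren-as-sub ρ (app T U) = cong₂ app (ren-as-sub ρ T) (ren-as-sub ρ U)
ren-as-sub ρ (T ⇒ U)   = cong₂ _⇒_ (ren-as-sub ρ T) (ren-as-sub ρ U)

sub-[] : ∀ τ T U → subst τ (T [ U ]) ≡ (subst (exts τ) T) [ subst τ U ]
sub-[] τ T U = begin
  subst τ (subst (sub0 U) T)                         ≡⟨ sub-sub τ (sub0 U) T ⟩
  subst (subst τ ∘ sub0 U) T                         ≡⟨ sub-cong pointwise T ⟩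
  subst (subst (sub0 (subst τ U)) ∘ exts τ) T        ≡⟨ sym (sub-sub _ (exts τ) T) ⟩
  subst (sub0 (subst τ U)) (subst (exts τ) T)        ∎
  where
  open ≡-Reasoning
  pointwise : ∀ x → subst τ (sub0 U x) ≡ subst (sub0 (subst τ U)) (exts τ x)
  pointwise zero    = refl
  pointwise (suc x) = sym (trans (sub-ren (sub0 (subst τ U)) suc (τ x)) (sub-id (τ x)))

ren-[] : ∀ ρ T U → rename ρ (T [ U ]) ≡ (rename (ext ρ) T) [ rename ρ U ]
ren-[] ρ T U = begin
  rename ρ (T [ U ])                                 ≡⟨ ren-as-sub ρ (T [ U ]) ⟩
  subst (var ∘ ρ) (T [ U ])                          ≡⟨ sub-[] (var ∘ ρ) T U ⟩
  (subst (exts (var ∘ ρ)) T) [ subst (var ∘ ρ) U ]   ≡⟨ sym (cong₂ _[_] as-sub (ren-as-sub ρ U)) ⟩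
  (rename (ext ρ) T) [ rename ρ U ]                  ∎
  where
  open ≡-Reasoning
  as-sub : rename (ext ρ) T ≡ subst (exts (var ∘ ρ)) T
  as-sub = trans (ren-as-sub (ext ρ) T) (sub-cong (ext-as-exts ρ) T)

-- Parallel reduction and the Church–Rosser property of ↔o*

infix 4 _⇛_
data _⇛_ : Ty → Ty → Set where
  p-con  : ∀ {F} → con F ⇛ con F
  p-var  : ∀ {x} → var x ⇛ var x
  p-lam  : ∀ {T T'} → T ⇛ T' → lam T ⇛ lam T'
  p-all  : ∀ {K T T'} → T ⇛ T' → all K T ⇛ all K T'
  p-app  : ∀ {T T' U U'} → T ⇛ T' → U ⇛ U' → app T U ⇛ app T' U'
  p-⇒    : ∀ {T T' U U'} → T ⇛ T' → U ⇛ U' → (T ⇒ U) ⇛ (T' ⇒ U')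
  p-beta : ∀ {T T' U U'} → T ⇛ T' → U ⇛ U' → app (lam T) U ⇛ (T' [ U' ])

_⇛*_ : Ty → Ty → Set
_⇛*_ = Star _⇛_

⇛-refl : ∀ T → T ⇛ T
⇛-refl (con F)   = p-con
⇛-refl (var x)   = p-var
⇛-refl (lam T)   = p-lam (⇛-refl T)
⇛-refl (all K T) = p-all (⇛-refl T)
⇛-refl (app T U) = p-app (⇛-refl T) (⇛-refl U)
⇛-refl (T ⇒ U)   = p-⇒ (⇛-refl T) (⇛-refl U)

→o⇒⇛ : ∀ {T T'} → T →o T' → T ⇛ T'
→o⇒⇛ (beta {T} {U})        = p-beta (⇛-refl T) (⇛-refl U)
→o⇒⇛ (ξ-lam r)             = p-lam (→o⇒⇛ r)
→o⇒⇛ (ξ-all r)             = p-all (→o⇒⇛ r)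
→o⇒⇛ (ξ-appˡ {U = U} r)    = p-app (→o⇒⇛ r) (⇛-refl U)
→o⇒⇛ (ξ-appʳ {T = T} r)    = p-app (⇛-refl T) (→o⇒⇛ r)
→o⇒⇛ (ξ-⇒ˡ {U = U} r)      = p-⇒ (→o⇒⇛ r) (⇛-refl U)
→o⇒⇛ (ξ-⇒ʳ {T = T} r)      = p-⇒ (⇛-refl T) (→o⇒⇛ r)

⇛-rename : ∀ ρ {T T'} → T ⇛ T' → rename ρ T ⇛ rename ρ T'
⇛-rename ρ p-con       = p-con
⇛-rename ρ p-var       = p-var
⇛-rename ρ (p-lam r)   = p-lam (⇛-rename (ext ρ) r)
⇛-rename ρ (p-all r)   = p-all (⇛-rename (ext ρ) r)
⇛-rename ρ (p-app r s) = p-app (⇛-rename ρ r) (⇛-rename ρ s)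
⇛-rename ρ (p-⇒ r s)   = p-⇒ (⇛-rename ρ r) (⇛-rename ρ s)
⇛-rename ρ (p-beta {T' = T'} {U' = U'} r s) =
  transport (_ ⇛_) (sym (ren-[] ρ T' U')) (p-beta (⇛-rename (ext ρ) r) (⇛-rename ρ s))

infix 4 _⇛ˢ_
_⇛ˢ_ : (ℕ → Ty) → (ℕ → Ty) → Set
σ ⇛ˢ τ = ∀ x → σ x ⇛ τ x

exts-⇛ : ∀ {σ τ} → σ ⇛ˢ τ → exts σ ⇛ˢ exts τ
exts-⇛ h zero    = p-var
exts-⇛ h (suc x) = ⇛-rename suc (h x)

⇛-subst : ∀ {σ τ} → σ ⇛ˢ τ → ∀ {T T'} → T ⇛ T' → subst σ T ⇛ subst τ T'
⇛-subst h p-con       = p-con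
⇛-subst h p-var       = h _
⇛-subst h (p-lam r)   = p-lam (⇛-subst (exts-⇛ h) r)
⇛-subst h (p-all r)   = p-all (⇛-subst (exts-⇛ h) r)
⇛-subst h (p-app r s) = p-app (⇛-subst h r) (⇛-subst h s)
⇛-subst h (p-⇒ r s)   = p-⇒ (⇛-subst h r) (⇛-subst h s)
⇛-subst {τ = τ} h (p-beta {T' = T'} {U' = U'} r s) =
  transport (_ ⇛_) (sym (sub-[] τ T' U')) (p-beta (⇛-subst (exts-⇛ h) r) (⇛-subst h s))

⇛-[] : ∀ {T T' U U'} → T ⇛ T' → U ⇛ U' → (T [ U ]) ⇛ (T' [ U' ])
⇛-[] {U = U} {U' = U'} r s = ⇛-subst sub0-⇛ r
  where
  sub0-⇛ : sub0 U ⇛ˢ sub0 U'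
  sub0-⇛ zero    = s
  sub0-⇛ (suc x) = p-var

develop : Ty → Ty
develop (con F)         = con F
develop (var x)         = var x
develop (lam T)         = lam (develop T)
develop (all K T)       = all K (develop T)
develop (app (lam T) U) = develop T [ develop U ]
develop (app T U)       = app (develop T) (develop U)
develop (T ⇒ U)         = develop T ⇒ develop U

triangle : ∀ {T T'} → T ⇛ T' → T' ⇛ develop T
triangle p-con                           = p-con
triangle p-var                           = p-var
triangle (p-lam r)                       = p-lam (triangle r)
triangle (p-all r)                       = p-all (triangle r)
triangle (p-app {T = con _} r s)         = p-app (triangle r) (triangle s)
triangle (p-app {T = var _} r s)         = p-app (triangle r) (triangle s)
triangle (p-app {T = lam _} (p-lam r) s) = p-beta (triangle r) (triangle s)
triangle (p-app {T = all _ _} r s)       = p-app (triangle r) (triangle s)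
triangle (p-app {T = app _ _} r s)       = p-app (triangle r) (triangle s)
triangle (p-app {T = _ ⇒ _} r s)         = p-app (triangle r) (triangle s)
triangle (p-⇒ r s)                       = p-⇒ (triangle r) (triangle s)
triangle (p-beta r s)                    = ⇛-[] (triangle r) (triangle s)

strip : ∀ {T T₁ T₂} → T ⇛ T₁ → T ⇛* T₂ → ∃[ S ] (T₁ ⇛* S × T₂ ⇛ S)
strip {T₁ = T₁} r ε = T₁ , ε , r
strip r (r' ◅ rs) with strip (triangle r') rs
... | S , T'⇛*S , T₂⇛S = S , triangle r ◅ T'⇛*S , T₂⇛S

church-rosser : ∀ {T T'} → T ↔o* T' → ∃[ S ] (T ⇛* S × T' ⇛* S)
church-rosser {T} ε = T , ε , ε
church-rosser (fwd r ◅ rs) with church-rosser rs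
... | S , U⇛*S , T'⇛*S = S , →o⇒⇛ r ◅ U⇛*S , T'⇛*S
church-rosser (bwd r ◅ rs) with church-rosser rs
... | S , U⇛*S , T'⇛*S with strip (→o⇒⇛ r) U⇛*S
... | S' , T⇛*S' , S⇛S' = S' , T⇛*S' , T'⇛*S ◅◅ (S⇛S' ◅ ε)

-- θ on base-argument types

-- Base-argument types: every argument of a type application erases to B.
-- On these types θ does not see the arguments consumed by β-reduction.
data BaseArgs : Ty → Set where
  b-con : ∀ {F} → BaseArgs (con F)
  b-var : ∀ {x} → BaseArgs (var x)
  b-lam : ∀ {T} → BaseArgs T → BaseArgs (lam T)
  b-all : ∀ {K T} → BaseArgs T → BaseArgs (all K T)
  b-app : ∀ {T U} → BaseArgs T → BaseArgs U → θ U ≡ B → BaseArgs (app T U)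
  b-⇒   : ∀ {T U} → BaseArgs T → BaseArgs U → BaseArgs (T ⇒ U)

-- θ ignores type variables, hence renamings.
θ-rename : ∀ ρ T → θ (rename ρ T) ≡ θ T
θ-rename ρ (con F)   = refl
θ-rename ρ (var x)   = refl
θ-rename ρ (lam T)   = θ-rename (ext ρ) T
θ-rename ρ (all K T) = θ-rename (ext ρ) T
θ-rename ρ (app T U) = θ-rename ρ T
θ-rename ρ (T ⇒ U)   = cong₂ _⇒Y_ (θ-rename ρ T) (θ-rename ρ U)

baseArgs-rename : ∀ ρ {T} → BaseArgs T → BaseArgs (rename ρ T)
baseArgs-rename ρ b-con             = b-con
baseArgs-rename ρ b-var             = b-var
baseArgs-rename ρ (b-lam b)         = b-lam (baseArgs-rename (ext ρ) b)
baseArgs-rename ρ (b-all b)         = b-all (baseArgs-rename (ext ρ) b)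
baseArgs-rename ρ (b-app {U = U} b c θU≡B) =
  b-app (baseArgs-rename ρ b) (baseArgs-rename ρ c) (trans (θ-rename ρ U) θU≡B)
baseArgs-rename ρ (b-⇒ b c)         = b-⇒ (baseArgs-rename ρ b) (baseArgs-rename ρ c)

-- Substitutions by base-argument types erasing to B, as variables do.
BaseSubst : (ℕ → Ty) → Set
BaseSubst σ = ∀ x → BaseArgs (σ x) × θ (σ x) ≡ B

exts-base : ∀ {σ} → BaseSubst σ → BaseSubst (exts σ)
exts-base h zero    = b-var , refl
exts-base {σ} h (suc x) with h x
... | b , θ≡B = baseArgs-rename suc b , trans (θ-rename suc (σ x)) θ≡B

sub0-base : ∀ {U} → BaseArgs U → θ U ≡ B → BaseSubst (sub0 U)
sub0-base b θU≡B zero    = b , θU≡B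
sub0-base b θU≡B (suc x) = b-var , refl

θ-subst : ∀ {σ} → BaseSubst σ → ∀ T → θ (subst σ T) ≡ θ T
θ-subst h (con F)   = refl
θ-subst h (var x)   with h x
... | _ , θ≡B = θ≡B
θ-subst h (lam T)   = θ-subst (exts-base h) T
θ-subst h (all K T) = θ-subst (exts-base h) T
θ-subst h (app T U) = θ-subst h T
θ-subst h (T ⇒ U)   = cong₂ _⇒Y_ (θ-subst h T) (θ-subst h U)

baseArgs-subst : ∀ {σ} → BaseSubst σ → ∀ {T} → BaseArgs T → BaseArgs (subst σ T)
baseArgs-subst h b-con           = b-con
baseArgs-subst h (b-var {x})     with h x
... | b , _ = b
baseArgs-subst h (b-lam b)       = b-lam (baseArgs-subst (exts-base h) b)
baseArgs-subst h (b-all b)       = b-all (baseArgs-subst (exts-base h) b)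
baseArgs-subst h (b-app {U = U} b c θU≡B) =
  b-app (baseArgs-subst h b) (baseArgs-subst h c) (trans (θ-subst h U) θU≡B)
baseArgs-subst h (b-⇒ b c)       = b-⇒ (baseArgs-subst h b) (baseArgs-subst h c)

⇛-preserves : ∀ {T T'} → T ⇛ T' → BaseArgs T → BaseArgs T' × θ T ≡ θ T'
⇛-preserves p-con b = b , refl
⇛-preserves p-var b = b , refl
⇛-preserves (p-lam r) (b-lam b) with ⇛-preserves r b
... | b' , θ≡ = b-lam b' , θ≡
⇛-preserves (p-all r) (b-all b) with ⇛-preserves r b
... | b' , θ≡ = b-all b' , θ≡
⇛-preserves (p-app r s) (b-app b c θU≡B) with ⇛-preserves r b | ⇛-preserves s c
... | b' , θT≡ | c' , θU≡ = b-app b' c' (trans (sym θU≡) θU≡B) , θT≡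
⇛-preserves (p-⇒ r s) (b-⇒ b c) with ⇛-preserves r b | ⇛-preserves s c
... | b' , θT≡ | c' , θU≡ = b-⇒ b' c' , cong₂ _⇒Y_ θT≡ θU≡
⇛-preserves (p-beta {T' = T'} r s) (b-app (b-lam b) c θU≡B)
  with ⇛-preserves r b | ⇛-preserves s c
... | b' , θT≡ | c' , θU≡ =
  baseArgs-subst base b' , trans θT≡ (sym (θ-subst base T'))
  where
  base : BaseSubst (sub0 _)
  base = sub0-base c' (trans (sym θU≡) θU≡B)

⇛*-preserves-θ : ∀ {T T'} → T ⇛* T' → BaseArgs T → θ T ≡ θ T'
⇛*-preserves-θ ε        b = refl
⇛*-preserves-θ (r ◅ rs) b with ⇛-preserves r b
... | b' , θ≡ = trans θ≡ (⇛*-preserves-θ rs b')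

θ-conv : ∀ {T T'} → T ↔o* T' → BaseArgs T → BaseArgs T' → θ T ≡ θ T'
θ-conv c b b' with church-rosser c
... | S , T⇛*S , T'⇛*S = trans (⇛*-preserves-θ T⇛*S b) (sym (⇛*-preserves-θ T'⇛*S b'))

-- Well-kinded types are base-argument types

termKind-θ : ∀ {Φ Ψ T K} → Φ ︔ Ψ ⊢ T ∶ ⌜ K ⌝ → θ T ≡ B
termKind-θ (k-con _)   = refl
termKind-θ (k-var _)   = refl
termKind-θ (k-app _ d) = termKind-θ d
termKind-θ (k-lam d _) = termKind-θ d

-- Arguments of applications have kind *, so they erase to B.
kinded-baseArgs : ∀ {Φ Ψ T k} → Φ ︔ Ψ ⊢ T ∶ k → BaseArgs T
kinded-baseArgs (k-con _)       = b-con
kinded-baseArgs (k-var _)       = b-var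
kinded-baseArgs (k-app d₁ d₂)   = b-app (kinded-baseArgs d₂) (kinded-baseArgs d₁) (termKind-θ d₁)
kinded-baseArgs (k-lam d _)     = b-lam (kinded-baseArgs d)
kinded-baseArgs (k-all (inj₁ d)) = b-all (kinded-baseArgs d)
kinded-baseArgs (k-all (inj₂ d)) = b-all (kinded-baseArgs d)
kinded-baseArgs (k-⇒ d d')      = b-⇒ (either d) (either d')
  where
  either : ∀ {Φ Ψ T} → Φ ︔ Ψ ⊢ T ∶ o ⊎ Φ ︔ Ψ ⊢ T ∶ ⌜ ⋆ ⌝ → BaseArgs T
  either (inj₁ d) = kinded-baseArgs d
  either (inj₂ d) = kinded-baseArgs d

type-baseArgs : ∀ {Φ Ψ T} → Φ ︔ Ψ ⊢ T type → BaseArgs T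
type-baseArgs (inj₁ d) = kinded-baseArgs d
type-baseArgs (inj₂ d) = kinded-baseArgs d

inst-base : ∀ {Φ Ψ U K} → Φ ︔ Ψ ⊢ U ∶ ⌜ K ⌝ → BaseSubst (sub0 U)
inst-base d = sub0-base (kinded-baseArgs d) (termKind-θ d)

-- The type of any typable evidence is a base-argument type; this is what
-- makes the kinding hypothesis of Theorem 28 derivable.
typed-baseArgs : ∀ {Φ Ψ Γ e T} → Φ ︔ Ψ ︔ Γ ⊢ e ∶ T → BaseArgs T
typed-baseArgs (t-var _ k)    = type-baseArgs k
typed-baseArgs (t-con _ k)    = type-baseArgs k
typed-baseArgs (t-app _ d)    with typed-baseArgs d
... | b-⇒ _ b = b
typed-baseArgs (t-lam k d)    = b-⇒ (type-baseArgs k) (typed-baseArgs d)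
typed-baseArgs (t-mu k _)     = type-baseArgs k
typed-baseArgs (t-inst d k)   with typed-baseArgs d
... | b-all b = baseArgs-subst (inst-base k) b
typed-baseArgs (t-abs d)      = b-all (typed-baseArgs d)
typed-baseArgs (t-conv _ _ k) = type-baseArgs k

lookupVar-map : ∀ {A B : Set} (f : A → B) Γ α →
  lookupVar (map (mapEntry f) Γ) α ≡ Maybe.map f (lookupVar Γ α)
lookupVar-map f []             α = refl
lookupVar-map f (evar β T ∷ Γ) α with α ≡ᵇ β
... | true  = refl
... | false = lookupVar-map f Γ α
lookupVar-map f (econ _ _ ∷ Γ) α = lookupVar-map f Γ α

lookupCon-map : ∀ {A B : Set} (f : A → B) Γ κ →
  lookupCon (map (mapEntry f) Γ) κ ≡ Maybe.map f (lookupCon Γ κ)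
lookupCon-map f []             κ = refl
lookupCon-map f (evar _ _ ∷ Γ) κ = lookupCon-map f Γ κ
lookupCon-map f (econ β T ∷ Γ) κ with κ ≡ᵇ β
... | true  = refl
... | false = lookupCon-map f Γ κ

θΓ-⇑ : ∀ Γ → θΓ (⇑ Γ) ≡ θΓ Γ
θΓ-⇑ []             = refl
θΓ-⇑ (evar α T ∷ Γ) = cong₂ (λ U Γ' → evar α U ∷ Γ') (θ-rename suc T) (θΓ-⇑ Γ)
θΓ-⇑ (econ κ T ∷ Γ) = cong₂ (λ U Γ' → econ κ U ∷ Γ') (θ-rename suc T) (θΓ-⇑ Γ)

erase : ∀ {Φ Ψ Γ e T} → Φ ︔ Ψ ︔ Γ ⊢ e ∶ T → θΓ Γ ⊢Y ∣ e ∣ ∶ θ T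
erase {Γ = Γ} (t-var {α = α} found _) =
  y-var (trans (lookupVar-map θ Γ α) (cong (Maybe.map θ) found))
erase {Γ = Γ} (t-con {κ = κ} found _) =
  y-con (trans (lookupCon-map θ Γ κ) (cong (Maybe.map θ) found))
erase (t-app d₁ d₂) = y-app (erase d₁) (erase d₂)
erase (t-lam _ d)   = y-lam (erase d)
erase (t-mu _ d)    = y-mu (erase d)
erase (t-inst {T = T} d k) =
  transport (_ ⊢Y _ ∶_) (sym (θ-subst (inst-base k) T)) (erase d)
erase {Γ = Γ} (t-abs d) = transport (_⊢Y _ ∶ _) (θΓ-⇑ Γ) (erase d)
erase (t-conv d c k) =
  transport (_ ⊢Y _ ∶_) (θ-conv c (typed-baseArgs d) (type-baseArgs k)) (erase d)

-- Theorem 28.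
theorem28 : (Φ : ConEnv) (Ψ : VarEnv) (Γ : Env) (e : Ev) (T : Ty)
    → Φ ︔ Ψ ︔ Γ ⊢ e ∶ T
    → (Φ ︔ Ψ ⊢ T ∶ ⌜ ⋆ ⌝ ⊎ Φ ︔ Ψ ⊢ T ∶ o)
    → θΓ Γ ⊢Y ∣ e ∣ ∶ θ T
theorem28 Φ Ψ Γ e T d _ = erase d
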